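{- For every positive integer $k$ and every integer $n \ge 3$, we have $\chi'_{st}(C_{3k} \,\square\, P_n) = 6$.
   Context: A star edge-coloring of a graph $G$ is a proper edge-coloring of $G$ in which there is no bichromatic path and no bichromatic cycle of length four (i.e., with four edges). The star chromatic index $\chi'_{st}(G)$ is the minimum number of colors in a star edge-coloring of $G$. $C_m$ denotes the cycle on $m$ vertices and $P_n$ the path on $n$ vertices. $G \,\square\, H$ denotes the Cartesian product: vertex set $V(G)\times V(H)$, with $(u,v)(u',v')$ an edge iff either $uu'\in E(G)$ and $v=v'$, or $u=u'$ and $vv'\in E(H)$. -}

module Defs where

open import Data.Nat using (ℕ; zero; suc; _+_; _*_; _≤_; NonZero)
open import Data.Fin using (Fin; toℕ)
open import Data.Product using (_×_; _,_; ∃; Σ)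
open import Data.Sum using (_⊎_)
open import Relation.Binary.PropositionalEquality using (_≡_; _≢_)
open import Relation.Nullary using (¬_)

-- A graph: a vertex type and an adjacency relation (the graphs used below,
-- C_m □ P_n with m ≥ 3, have symmetric irreflexive adjacency, i.e. are simple).
record Graph : Set₁ where
  field
    V    : Set
    Adj  : V → V → Set
open Graph public

-- An edge colouring with colours Fin m: a colour for every ordered pair of
-- vertices, required to be symmetric on edges (so it is a colouring of the
-- undirected edges; values on non-edges are irrelevant).
record EdgeColouring (G : Graph) (m : ℕ) : Set where
  field
    col     : V G → V G → Fin m
    col-sym : ∀ {u v} → Adj G u v → col u v ≡ col v u
open EdgeColouring public

Proper : (G : Graph) {m : ℕ} → EdgeColouring G m → Set
Proper G c = ∀ {u v w} → Adj G u v → Adj G v w → u ≢ w →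
             col c u v ≢ col c v w

-- A bichromatic path or 4-cycle with four edges: a walk v0 v1 v2 v3 v4 with
-- v0,v1,v2,v3 pairwise distinct and v4 distinct from v1,v2,v3 (so either
-- v4 ≠ v0, a path with 4 edges, or v4 = v0, a cycle of length 4), whose
-- edges alternate between two colours.
BichromaticP4orC4 : (G : Graph) {m : ℕ} → EdgeColouring G m → Set
BichromaticP4orC4 G c =
  Σ (V G) λ v0 → Σ (V G) λ v1 → Σ (V G) λ v2 → Σ (V G) λ v3 → Σ (V G) λ v4 →
    Adj G v0 v1 × Adj G v1 v2 × Adj G v2 v3 × Adj G v3 v4 ×
    v0 ≢ v1 × v0 ≢ v2 × v0 ≢ v3 × v1 ≢ v2 × v1 ≢ v3 × v2 ≢ v3 ×
    v4 ≢ v1 × v4 ≢ v2 × v4 ≢ v3 ×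
    col c v0 v1 ≡ col c v2 v3 × col c v1 v2 ≡ col c v3 v4

IsStarEdgeColouring : (G : Graph) {m : ℕ} → EdgeColouring G m → Set
IsStarEdgeColouring G c = Proper G c × ¬ BichromaticP4orC4 G c

StarColourable : Graph → ℕ → Set
StarColourable G m = Σ (EdgeColouring G m) λ c → IsStarEdgeColouring G c

StarChromaticIndex≡ : Graph → ℕ → Set
StarChromaticIndex≡ G s = StarColourable G s × (∀ m → StarColourable G m → s ≤ m)

CycleStep : (m : ℕ) → Fin m → Fin m → Set
CycleStep m i j = (toℕ j ≡ suc (toℕ i)) ⊎ (suc (toℕ i) ≡ m × toℕ j ≡ 0)

CycleAdj : (m : ℕ) → Fin m → Fin m → Set
CycleAdj m i j = CycleStep m i j ⊎ CycleStep m j i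

PathAdj : (n : ℕ) → Fin n → Fin n → Set
PathAdj n i j = (toℕ j ≡ suc (toℕ i)) ⊎ (toℕ i ≡ suc (toℕ j))

CycleBoxPath : (m n : ℕ) → Graph
CycleBoxPath m n = record
  { V   = Fin m × Fin n
  ; Adj = λ { (u , v) (u' , v') →
              (CycleAdj m u u' × v ≡ v') ⊎ (u ≡ u' × PathAdj n v v') } }

module Submission where

-- Upper bound: give the edge from (i , j) to (i + 1 , j) the colour (i + j) mod 3 and the edge
-- from (i , j) to (i , j + 1) the colour 3 + (j - i) mod 3.  As 3 divides the length of the cycle,
-- the colour of an edge depends only on its start and direction in the torus ℤ₃ × ℤ₃, and a walk
-- in C_{3k} □ P_n that does not backtrack projects to such a walk on the torus; properness and the
-- absence of bichromatic paths and 4-cycles then become finitely many checks on the torus.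
-- Lower bound: C₃ □ P₃ (for k = 1) and P₅ □ P₃ (for k ≥ 2) are subgraphs of C_{3k} □ P_n, and
-- neither has a star edge-colouring with five colours.  After permuting colours, the four edges
-- at a vertex of degree four are coloured 0, 1, 2, 3, and an exhaustive search over the colours of
-- the remaining edges, pruned by the star condition, finds no completion.

open import Defs
open import Data.Bool using (true; false; T; if_then_else_)
open import Data.Empty using (⊥; ⊥-elim)
open import Data.Fin using (Fin; toℕ; inject≤; _↑ˡ_; _↑ʳ_) renaming (_≟_ to _≟ᶠ_)
open import Data.Fin.Patterns
open import Data.Fin.Properties using (all?; toℕ-injective; toℕ<n; toℕ-inject≤; inject≤-injective)
open import Data.List using (List; []; _∷_; _++_; length; filter; upTo)
open import Data.List.Effectful using (monad)
open import Data.List.Relation.Unary.All as All using (All; []; _∷_; lookupAny)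
open import Data.List.Relation.Unary.All.Properties using (all-filter; filter⁺)
open import Data.List.Relation.Unary.Any as Any using (Any; any?)
open import Data.Maybe using (Maybe; just; nothing)
open import Data.Maybe.Properties using (just-injective)
open import Data.Nat using (ℕ; zero; suc; _*_; _≤_; _<_; _<ᵇ_; _≡ᵇ_; _⊔_; _∸_; z≤n; s≤s)
  renaming (_≟_ to _≟ⁿ_)
open import Data.Nat.Divisibility using (_∣_; divides; m∣m*n)
open import Data.Nat.Properties using (≡ᵇ⇒≡; ≰⇒>; _≤?_; suc-injective; <-irrefl; ≤-trans; n≤1+n; *-monoʳ-≤)
open import Data.Product using (Σ; _×_; _,_; proj₁; proj₂; uncurry)
open import Data.Product.Properties using (≡-dec; ,-injectiveˡ; ,-injectiveʳ)
open import Data.Sum using (_⊎_; inj₁; inj₂)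
open import Data.Unit using (tt)
open import Effect.Monad using (RawMonad)
open import Function using (_∘_)
open import Function.Definitions using (Injective)
open import Level using (0ℓ)
open import Relation.Binary.Definitions using (Decidable; DecidableEquality)
open import Relation.Binary.PropositionalEquality
  using (_≡_; _≢_; refl; sym; trans; cong; cong₂; subst; module ≡-Reasoning)
open import Relation.Nullary using (Dec; yes; no; does; ¬_)
open import Relation.Nullary.Decidable using (_×-dec_; _⊎-dec_; _→-dec_; ¬?; map′; from-yes)

private variable
  G H : Graph
  m m' n n' s : ℕ

-- Recolourings and subgraphs

recolour : (Fin m → Fin m') → EdgeColouring G m → EdgeColouring G m'
recolour π c = record { col = λ u v → π (col c u v) ; col-sym = λ a → cong π (col-sym c a) }

recolour-star : {π : Fin m → Fin m'} → Injective _≡_ _≡_ π → (c : EdgeColouring G m) →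
                IsStarEdgeColouring G c → IsStarEdgeColouring G (recolour π c)
recolour-star π-inj c (proper , no-bichromatic) =
  (λ a₁ a₂ u≢w same → proper a₁ a₂ u≢w (π-inj same)) ,
  (λ (v₀ , v₁ , v₂ , v₃ , v₄ , a₁ , a₂ , a₃ , a₄ , d₀₁ , d₀₂ , d₀₃ , d₁₂ , d₁₃ , d₂₃ , d₄₁ , d₄₂ , d₄₃ , c₁₃ , c₂₄) →
     no-bichromatic (v₀ , v₁ , v₂ , v₃ , v₄ , a₁ , a₂ , a₃ , a₄ ,
                     d₀₁ , d₀₂ , d₀₃ , d₁₂ , d₁₃ , d₂₃ , d₄₁ , d₄₂ , d₄₃ , π-inj c₁₃ , π-inj c₂₄))

StarColourable-≤ : m ≤ m' → StarColourable G m → StarColourable G m'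
StarColourable-≤ m≤m' (c , star) =
  recolour (λ x → inject≤ x m≤m') c , recolour-star (inject≤-injective m≤m' m≤m' _ _) c star

¬StarColourable⇒< : ¬ StarColourable G s → ∀ m → StarColourable G m → s < m
¬StarColourable⇒< {s = s} not-s m colourable with m ≤? s
... | yes m≤s = ⊥-elim (not-s (StarColourable-≤ m≤s colourable))
... | no m≰s  = ≰⇒> m≰s

record _↪_ (H G : Graph) : Set where
  field
    vertex           : V H → V G
    vertex-injective : ∀ {u v} → vertex u ≡ vertex v → u ≡ v
    adjacency        : ∀ {u v} → Adj H u v → Adj G (vertex u) (vertex v)

StarColourable-↪ : H ↪ G → StarColourable G m → StarColourable H m
StarColourable-↪ {H} {G} φ (c , proper , no-bichromatic) = c' , proper' , no-bichromatic'
  where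
  open _↪_ φ
  separate : ∀ {u v} → u ≢ v → vertex u ≢ vertex v
  separate u≢v = u≢v ∘ vertex-injective
  c' : EdgeColouring H _
  c' = record { col = λ u v → col c (vertex u) (vertex v) ; col-sym = col-sym c ∘ adjacency }
  proper' : Proper H c'
  proper' a₁ a₂ u≢w = proper (adjacency a₁) (adjacency a₂) (separate u≢w)
  no-bichromatic' : ¬ BichromaticP4orC4 H c'
  no-bichromatic' (v₀ , v₁ , v₂ , v₃ , v₄ , a₁ , a₂ , a₃ , a₄ ,
                   d₀₁ , d₀₂ , d₀₃ , d₁₂ , d₁₃ , d₂₃ , d₄₁ , d₄₂ , d₄₃ , c₁₃ , c₂₄) =
    no-bichromatic (vertex v₀ , vertex v₁ , vertex v₂ , vertex v₃ , vertex v₄ ,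
                    adjacency a₁ , adjacency a₂ , adjacency a₃ , adjacency a₄ ,
                    separate d₀₁ , separate d₀₂ , separate d₀₃ , separate d₁₂ , separate d₁₃ ,
                    separate d₂₃ , separate d₄₁ , separate d₄₂ , separate d₄₃ , c₁₃ , c₂₄)

PathBoxPath : ℕ → ℕ → Graph
PathBoxPath m n = record
  { V   = Fin m × Fin n
  ; Adj = λ { (u , v) (u' , v') → (PathAdj m u u' × v ≡ v') ⊎ (u ≡ u' × PathAdj n v v') } }

PathAdj⇒CycleAdj : ∀ {i j} → PathAdj m i j → CycleAdj m i j
PathAdj⇒CycleAdj (inj₁ p) = inj₁ (inj₁ p)
PathAdj⇒CycleAdj (inj₂ p) = inj₂ (inj₁ p)

PathAdj-inject≤ : (m≤m' : m ≤ m') → ∀ {i j} → PathAdj m i j → PathAdj m' (inject≤ i m≤m') (inject≤ j m≤m')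
PathAdj-inject≤ m≤m' {i} {j} adj
  rewrite toℕ-inject≤ i m≤m' | toℕ-inject≤ j m≤m' = adj

CycleBoxPath-↪ : n ≤ n' → CycleBoxPath m n ↪ CycleBoxPath m n'
CycleBoxPath-↪ {n = n} {n' = n'} {m = m} n≤n' =
  record { vertex = widen ; vertex-injective = widen-injective ; adjacency = widen-adjacency }
  where
  widen : Fin m × Fin n → Fin m × Fin n'
  widen (u , v) = u , inject≤ v n≤n'
  widen-injective : ∀ {x y} → widen x ≡ widen y → x ≡ y
  widen-injective eq = cong₂ _,_ (,-injectiveˡ eq) (inject≤-injective _ _ _ _ (,-injectiveʳ eq))
  widen-adjacency : ∀ {x y} → Adj (CycleBoxPath m n) x y → Adj (CycleBoxPath m n') (widen x) (widen y)
  widen-adjacency (inj₁ (a , refl)) = inj₁ (a , refl)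
  widen-adjacency (inj₂ (refl , p)) = inj₂ (refl , PathAdj-inject≤ n≤n' p)

PathBoxPath-↪ : m ≤ m' → n ≤ n' → PathBoxPath m n ↪ CycleBoxPath m' n'
PathBoxPath-↪ {m = m} {m' = m'} {n = n} {n' = n'} m≤m' n≤n' =
  record { vertex = widen ; vertex-injective = widen-injective ; adjacency = widen-adjacency }
  where
  widen : Fin m × Fin n → Fin m' × Fin n'
  widen (u , v) = inject≤ u m≤m' , inject≤ v n≤n'
  widen-injective : ∀ {x y} → widen x ≡ widen y → x ≡ y
  widen-injective eq = cong₂ _,_ (inject≤-injective _ _ _ _ (,-injectiveˡ eq))
                                 (inject≤-injective _ _ _ _ (,-injectiveʳ eq))
  widen-adjacency : ∀ {x y} → Adj (PathBoxPath m n) x y → Adj (CycleBoxPath m' n') (widen x) (widen y)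
  widen-adjacency (inj₁ (p , refl)) = inj₁ (PathAdj⇒CycleAdj (PathAdj-inject≤ m≤m' p) , refl)
  widen-adjacency (inj₂ (refl , p)) = inj₂ (refl , PathAdj-inject≤ n≤n' p)

CycleStep? : ∀ m → Decidable (CycleStep m)
CycleStep? m i j = (toℕ j ≟ⁿ suc (toℕ i)) ⊎-dec (suc (toℕ i) ≟ⁿ m ×-dec toℕ j ≟ⁿ 0)

CycleAdj? : ∀ m → Decidable (CycleAdj m)
CycleAdj? m i j = CycleStep? m i j ⊎-dec CycleStep? m j i

PathAdj? : ∀ n → Decidable (PathAdj n)
PathAdj? n i j = (toℕ j ≟ⁿ suc (toℕ i)) ⊎-dec (toℕ i ≟ⁿ suc (toℕ j))

CycleBoxPath-adjacent? : ∀ m n → Decidable (Adj (CycleBoxPath m n))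
CycleBoxPath-adjacent? m n (u , v) (u' , v') =
  (CycleAdj? m u u' ×-dec v ≟ᶠ v') ⊎-dec (u ≟ᶠ u' ×-dec PathAdj? n v v')

PathBoxPath-adjacent? : ∀ m n → Decidable (Adj (PathBoxPath m n))
PathBoxPath-adjacent? m n (u , v) (u' , v') =
  (PathAdj? m u u' ×-dec v ≟ᶠ v') ⊎-dec (u ≟ᶠ u' ×-dec PathAdj? n v v')

-- Six colours suffice

next prev : Fin 3 → Fin 3
next 0F = 1F
next 1F = 2F
next 2F = 0F
prev 0F = 2F
prev 1F = 0F
prev 2F = 1F

prev-next : ∀ x → prev (next x) ≡ x
prev-next 0F = refl
prev-next 1F = refl
prev-next 2F = refl

residue : ℕ → Fin 3
residue zero    = 0F
residue (suc n) = next (residue n)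

residue-multiple : ∀ q → residue (q * 3) ≡ 0F
residue-multiple zero    = refl
residue-multiple (suc q) = cong (λ r → next (next (next r))) (residue-multiple q)

residue-divisible : ∀ {m} → 3 ∣ m → residue m ≡ 0F
residue-divisible (divides q refl) = residue-multiple q

Torus : Set
Torus = Fin 3 × Fin 3

all-torus? : {P : Torus → Set} → (∀ p → Dec (P p)) → Dec (∀ p → P p)
all-torus? P? = map′ (λ f (x , y) → f x y) (λ f x y → f (x , y)) (all? λ x → all? λ y → P? (x , y))

Direction : Set
Direction = Fin 4

pattern east  = 0F
pattern west  = 1F
pattern north = 2F
pattern south = 3F

opposite : Direction → Direction
opposite east  = west
opposite west  = east
opposite north = south
opposite south = north

move : Direction → Torus → Torus
move east  (x , y) = next x , y
move west  (x , y) = prev x , y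
move north (x , y) = x , next y
move south (x , y) = x , prev y

_⊕_ _⊖_ : Fin 3 → Fin 3 → Fin 3
0F ⊕ y = y
1F ⊕ y = next y
2F ⊕ y = prev y
y ⊖ 0F = y
y ⊖ 1F = prev y
y ⊖ 2F = next y

stepColour : Direction → Torus → Fin 6
stepColour east  (x , y) = (x ⊕ y) ↑ˡ 3
stepColour west  p       = stepColour east (move west p)
stepColour north (x , y) = 3 ↑ʳ (y ⊖ x)
stepColour south p       = stepColour north (move south p)

_≟ᵗ_ : (p q : Torus) → Dec (p ≡ q)
_≟ᵗ_ = ≡-dec _≟ᶠ_ _≟ᶠ_

colourBetween : Torus → Torus → Fin 6
colourBetween p q =
  if does (q ≟ᵗ move east p) then stepColour east p else
  if does (q ≟ᵗ move west p) then stepColour west p else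
  if does (q ≟ᵗ move north p) then stepColour north p else stepColour south p

colourBetween-move : ∀ d p → colourBetween p (move d p) ≡ stepColour d p
colourBetween-move = from-yes (all? λ d → all-torus? λ p → colourBetween p (move d p) ≟ᶠ stepColour d p)

stepColour-opposite : ∀ d p → stepColour (opposite d) (move d p) ≡ stepColour d p
stepColour-opposite = from-yes (all? λ d → all-torus? λ p → stepColour (opposite d) (move d p) ≟ᶠ stepColour d p)

turn-changes-colour : ∀ p d₁ d₂ → d₂ ≢ opposite d₁ → stepColour d₁ p ≢ stepColour d₂ (move d₁ p)
turn-changes-colour = from-yes (all-torus? λ p → all? λ d₁ → all? λ d₂ →
  ¬? (d₂ ≟ᶠ opposite d₁) →-dec ¬? (stepColour d₁ p ≟ᶠ stepColour d₂ (move d₁ p)))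

no-alternating-walk : ∀ p d₁ d₂ d₃ d₄ → d₂ ≢ opposite d₁ → d₃ ≢ opposite d₂ → d₄ ≢ opposite d₃ →
  stepColour d₁ p ≡ stepColour d₃ (move d₂ (move d₁ p)) →
  stepColour d₂ (move d₁ p) ≢ stepColour d₄ (move d₃ (move d₂ (move d₁ p)))
no-alternating-walk = from-yes (all-torus? λ p → all? λ d₁ → all? λ d₂ → all? λ d₃ → all? λ d₄ →
  ¬? (d₂ ≟ᶠ opposite d₁) →-dec ¬? (d₃ ≟ᶠ opposite d₂) →-dec ¬? (d₄ ≟ᶠ opposite d₃) →-dec
  (stepColour d₁ p ≟ᶠ stepColour d₃ (move d₂ (move d₁ p))) →-dec
  ¬? (stepColour d₂ (move d₁ p) ≟ᶠ stepColour d₄ (move d₃ (move d₂ (move d₁ p)))))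

module ResidueColouring {m n : ℕ} (3∣m : 3 ∣ m) where

  Vertex : Set
  Vertex = Fin m × Fin n

  Step : Direction → Vertex → Vertex → Set
  Step east  (i , j) (i' , j') = CycleStep m i i' × j ≡ j'
  Step west  (i , j) (i' , j') = CycleStep m i' i × j ≡ j'
  Step north (i , j) (i' , j') = i ≡ i' × toℕ j' ≡ suc (toℕ j)
  Step south (i , j) (i' , j') = i ≡ i' × toℕ j ≡ suc (toℕ j')

  adjacent-step : ∀ {u v} → Adj (CycleBoxPath m n) u v → Σ Direction λ d → Step d u v
  adjacent-step (inj₁ (inj₁ s , e)) = east , s , e
  adjacent-step (inj₁ (inj₂ s , e)) = west , s , e
  adjacent-step (inj₂ (e , inj₁ s)) = north , e , s
  adjacent-step (inj₂ (e , inj₂ s)) = south , e , s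

  step-reverse : ∀ d {u v} → Step d u v → Step (opposite d) v u
  step-reverse east  (s , e) = s , sym e
  step-reverse west  (s , e) = s , sym e
  step-reverse north (e , s) = sym e , s
  step-reverse south (e , s) = sym e , s

  cycle-successor-unique : ∀ {i j j'} → CycleStep m i j → CycleStep m i j' → j ≡ j'
  cycle-successor-unique (inj₁ p) (inj₁ q) = toℕ-injective (trans p (sym q))
  cycle-successor-unique {j = j} (inj₁ p) (inj₂ (q , _)) = ⊥-elim (<-irrefl (trans p q) (toℕ<n j))
  cycle-successor-unique {j' = j'} (inj₂ (p , _)) (inj₁ q) = ⊥-elim (<-irrefl (trans q p) (toℕ<n j'))
  cycle-successor-unique (inj₂ (_ , p)) (inj₂ (_ , q)) = toℕ-injective (trans p (sym q))

  cycle-predecessor-unique : ∀ {i i' j} → CycleStep m i j → CycleStep m i' j → i ≡ i'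
  cycle-predecessor-unique (inj₁ p) (inj₁ q) = toℕ-injective (suc-injective (trans (sym p) q))
  cycle-predecessor-unique (inj₁ p) (inj₂ (_ , q)) with () ← trans (sym p) q
  cycle-predecessor-unique (inj₂ (_ , p)) (inj₁ q) with () ← trans (sym q) p
  cycle-predecessor-unique (inj₂ (p , _)) (inj₂ (q , _)) = toℕ-injective (suc-injective (trans p (sym q)))

  step-unique : ∀ d {u v w} → Step d u v → Step d u w → v ≡ w
  step-unique east  (s , refl) (t , refl) = cong (_, _) (cycle-successor-unique s t)
  step-unique west  (s , refl) (t , refl) = cong (_, _) (cycle-predecessor-unique s t)
  step-unique north (refl , s) (refl , t) = cong (_ ,_) (toℕ-injective (trans s (sym t)))
  step-unique south (refl , s) (refl , t) = cong (_ ,_) (toℕ-injective (suc-injective (trans (sym s) t)))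

  non-backtracking : ∀ {d₁ d₂ u v w} → Step d₁ u v → Step d₂ v w → u ≢ w → d₂ ≢ opposite d₁
  non-backtracking {d₁} s t u≢w refl = u≢w (step-unique (opposite d₁) (step-reverse d₁ s) t)

  position : Vertex → Torus
  position (i , j) = residue (toℕ i) , residue (toℕ j)

  residue-cycle-step : ∀ {i i'} → CycleStep m i i' → residue (toℕ i') ≡ next (residue (toℕ i))
  residue-cycle-step (inj₁ p) = cong residue p
  residue-cycle-step (inj₂ (p , q)) =
    trans (cong residue q) (sym (trans (cong residue p) (residue-divisible 3∣m)))

  step-position : ∀ d {u v} → Step d u v → position v ≡ move d (position u)
  step-position east  (s , refl) = cong (_, _) (residue-cycle-step s)
  step-position west  (s , refl) = cong (_, _) (trans (sym (prev-next _)) (cong prev (sym (residue-cycle-step s))))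
  step-position north (refl , s) = cong (_ ,_) (cong residue s)
  step-position south (refl , s) = cong (_ ,_) (trans (sym (prev-next _)) (cong prev (sym (cong residue s))))

  step-colour : ∀ d {u v} → Step d u v →
                colourBetween (position u) (position v) ≡ stepColour d (position u)
  step-colour d s = trans (cong (colourBetween _) (step-position d s)) (colourBetween-move d _)

  colouring : EdgeColouring (CycleBoxPath m n) 6
  colouring = record { col = λ u v → colourBetween (position u) (position v) ; col-sym = symmetric }
    where
    open ≡-Reasoning
    symmetric : ∀ {u v} → Adj (CycleBoxPath m n) u v →
                colourBetween (position u) (position v) ≡ colourBetween (position v) (position u)
    symmetric a with d , s ← adjacent-step a = begin
      _                                  ≡⟨ step-colour d s ⟩
      stepColour d _                     ≡⟨ stepColour-opposite d _ ⟨
      stepColour (opposite d) (move d _) ≡⟨ cong (stepColour (opposite d)) (step-position d s) ⟨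
      stepColour (opposite d) _          ≡⟨ step-colour (opposite d) (step-reverse d s) ⟨
      _                                  ∎

  colouring-proper : Proper (CycleBoxPath m n) colouring
  colouring-proper {u} a₁ a₂ u≢w same
    with d₁ , s₁ ← adjacent-step a₁ | d₂ , s₂ ← adjacent-step a₂ =
    turn-changes-colour (position u) d₁ d₂ (non-backtracking s₁ s₂ u≢w) (begin
      stepColour d₁ (position u)              ≡⟨ step-colour d₁ s₁ ⟨
      _                                       ≡⟨ same ⟩
      _                                       ≡⟨ step-colour d₂ s₂ ⟩
      stepColour d₂ _                         ≡⟨ cong (stepColour d₂) (step-position d₁ s₁) ⟩
      stepColour d₂ (move d₁ (position u))    ∎)
    where open ≡-Reasoning

  colouring-no-bichromatic : ¬ BichromaticP4orC4 (CycleBoxPath m n) colouring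
  colouring-no-bichromatic
    (v₀ , v₁ , v₂ , v₃ , v₄ , a₁ , a₂ , a₃ , a₄ , _ , v₀≢v₂ , _ , _ , v₁≢v₃ , _ , _ , v₄≢v₂ , _ , c₁₃ , c₂₄)
    with d₁ , s₁ ← adjacent-step a₁ | d₂ , s₂ ← adjacent-step a₂
       | d₃ , s₃ ← adjacent-step a₃ | d₄ , s₄ ← adjacent-step a₄ =
    no-alternating-walk p d₁ d₂ d₃ d₄
      (non-backtracking s₁ s₂ v₀≢v₂) (non-backtracking s₂ s₃ v₁≢v₃)
      (non-backtracking s₃ s₄ (λ e → v₄≢v₂ (sym e)))
      (trans (sym (step-colour d₁ s₁)) (trans c₁₃ (trans (step-colour d₃ s₃) (cong (stepColour d₃) p₂))))
      (trans (sym (trans (step-colour d₂ s₂) (cong (stepColour d₂) p₁)))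
             (trans c₂₄ (trans (step-colour d₄ s₄) (cong (stepColour d₄) p₃))))
    where
    p : Torus
    p = position v₀
    p₁ : position v₁ ≡ move d₁ p
    p₁ = step-position d₁ s₁
    p₂ : position v₂ ≡ move d₂ (move d₁ p)
    p₂ = trans (step-position d₂ s₂) (cong (move d₂) p₁)
    p₃ : position v₃ ≡ move d₃ (move d₂ (move d₁ p))
    p₃ = trans (step-position d₃ s₃) (cong (move d₃) p₂)

CycleBoxPath-star-6 : 3 ∣ m → StarColourable (CycleBoxPath m n) 6
CycleBoxPath-star-6 3∣m = colouring , colouring-proper , colouring-no-bichromatic
  where open ResidueColouring 3∣m

-- Five colours are not enough

normalise : (a b c d : Fin 5) → Fin 5 → Fin 5
normalise a b c d x =
  if does (x ≟ᶠ a) then 0F else if does (x ≟ᶠ b) then 1F else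
  if does (x ≟ᶠ c) then 2F else if does (x ≟ᶠ d) then 3F else 4F

-- Opaque: letting the type checker unfold the decision behind this lemma is prohibitively slow.
opaque
  normalise-correct : ∀ a b c d → a ≢ b → a ≢ c → a ≢ d → b ≢ c → b ≢ d → c ≢ d →
    (∀ x y → normalise a b c d x ≡ normalise a b c d y → x ≡ y) ×
    normalise a b c d a ≡ 0F × normalise a b c d b ≡ 1F × normalise a b c d c ≡ 2F × normalise a b c d d ≡ 3F
  normalise-correct = from-yes (all? λ a → all? λ b → all? λ c → all? λ d →
    ¬? (a ≟ᶠ b) →-dec ¬? (a ≟ᶠ c) →-dec ¬? (a ≟ᶠ d) →-dec ¬? (b ≟ᶠ c) →-dec ¬? (b ≟ᶠ d) →-dec ¬? (c ≟ᶠ d) →-dec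
    (all? λ x → all? λ y → (normalise a b c d x ≟ᶠ normalise a b c d y) →-dec (x ≟ᶠ y)) ×-dec
    normalise a b c d a ≟ᶠ 0F ×-dec normalise a b c d b ≟ᶠ 1F ×-dec
    normalise a b c d c ≟ᶠ 2F ×-dec normalise a b c d d ≟ᶠ 3F)

normalising-recolouring : ∀ {a b c d} → a ≢ b → a ≢ c → a ≢ d → b ≢ c → b ≢ d → c ≢ d →
  Σ (Fin 5 → Fin 5) λ π → Injective _≡_ _≡_ π × π a ≡ 0F × π b ≡ 1F × π c ≡ 2F × π d ≡ 3F
normalising-recolouring {a} {b} {c} {d} a≢b a≢c a≢d b≢c b≢d c≢d
  with injective , eqs ← normalise-correct a b c d a≢b a≢c a≢d b≢c b≢d c≢d =
  normalise a b c d , injective _ _ , eqs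

module Certificate (G : Graph) (adjacent? : Decidable (Adj G)) (_≟_ : DecidableEquality (V G))
                   (edge : ℕ → V G × V G) where

  Joins : V G × V G → V G → V G → Set
  Joins (a , b) u v = (a ≡ u × b ≡ v) ⊎ (a ≡ v × b ≡ u)

  joins? : ∀ e u v → Dec (Joins e u v)
  joins? (a , b) u v = (a ≟ u ×-dec b ≟ v) ⊎-dec (a ≟ v ×-dec b ≟ u)

  -- An obstruction names, by their positions in the edge order, two edges that a star
  -- colouring must colour differently, or the four edges of a path or 4-cycle that must not
  -- alternate in colour; the vertices are recorded so that this can be checked.
  data Obstruction : Set where
    clash       : (u v w : V G) (i j : ℕ) → Obstruction
    alternation : (v₀ v₁ v₂ v₃ v₄ : V G) (i₁ i₂ i₃ i₄ : ℕ) → Obstruction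

  Genuine : Obstruction → Set
  Genuine (clash u v w i j) =
    Adj G u v × Adj G v w × u ≢ w × Joins (edge i) u v × Joins (edge j) v w
  Genuine (alternation v₀ v₁ v₂ v₃ v₄ i₁ i₂ i₃ i₄) =
    (Adj G v₀ v₁ × Adj G v₁ v₂ × Adj G v₂ v₃ × Adj G v₃ v₄) ×
    (v₀ ≢ v₁ × v₀ ≢ v₂ × v₀ ≢ v₃ × v₁ ≢ v₂ × v₁ ≢ v₃ × v₂ ≢ v₃ × v₄ ≢ v₁ × v₄ ≢ v₂ × v₄ ≢ v₃) ×
    (Joins (edge i₁) v₀ v₁ × Joins (edge i₂) v₁ v₂ × Joins (edge i₃) v₂ v₃ × Joins (edge i₄) v₃ v₄)

  genuine? : (o : Obstruction) → Dec (Genuine o)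
  genuine? (clash u v w i j) =
    adjacent? u v ×-dec adjacent? v w ×-dec ¬? (u ≟ w) ×-dec
    joins? (edge i) u v ×-dec joins? (edge j) v w
  genuine? (alternation v₀ v₁ v₂ v₃ v₄ i₁ i₂ i₃ i₄) =
    (adjacent? v₀ v₁ ×-dec adjacent? v₁ v₂ ×-dec adjacent? v₂ v₃ ×-dec adjacent? v₃ v₄) ×-dec
    (¬? (v₀ ≟ v₁) ×-dec ¬? (v₀ ≟ v₂) ×-dec ¬? (v₀ ≟ v₃) ×-dec ¬? (v₁ ≟ v₂) ×-dec ¬? (v₁ ≟ v₃) ×-dec
     ¬? (v₂ ≟ v₃) ×-dec ¬? (v₄ ≟ v₁) ×-dec ¬? (v₄ ≟ v₂) ×-dec ¬? (v₄ ≟ v₃)) ×-dec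
    (joins? (edge i₁) v₀ v₁ ×-dec joins? (edge i₂) v₁ v₂ ×-dec joins? (edge i₃) v₂ v₃ ×-dec
     joins? (edge i₄) v₃ v₄)

  module _ {k : ℕ} where

    Assignment : Set
    Assignment = ℕ → Maybe (Fin k)

    unassigned : Assignment
    unassigned _ = nothing

    _[_≔_] : Assignment → ℕ → Fin k → Assignment
    (σ [ i ≔ x ]) j = if i ≡ᵇ j then just x else σ j

    _≐_ : Maybe (Fin k) → Maybe (Fin k) → Set
    just x ≐ just y = x ≡ y
    _      ≐ _      = ⊥

    _≐?_ : ∀ a b → Dec (a ≐ b)
    just x  ≐? just y  = x ≟ᶠ y
    just _  ≐? nothing = no λ ()
    nothing ≐? _       = no λ ()

    Hit : Assignment → Obstruction → Set
    Hit σ (clash _ _ _ i j)                    = σ i ≐ σ j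
    Hit σ (alternation _ _ _ _ _ i₁ i₂ i₃ i₄) = σ i₁ ≐ σ i₃ × σ i₂ ≐ σ i₄

    hit? : ∀ σ o → Dec (Hit σ o)
    hit? σ (clash _ _ _ i j)                    = σ i ≐? σ j
    hit? σ (alternation _ _ _ _ _ i₁ i₂ i₃ i₄) = (σ i₁ ≐? σ i₃) ×-dec (σ i₂ ≐? σ i₄)

    -- σ colours the edges before position i, and the r-th stage of the plan lists the
    -- obstructions whose last edge is at position i + r.
    Refuted : ℕ → List (List Obstruction) → Assignment → Set
    Refuted i []          σ = ⊥
    Refuted i (os ∷ plan) σ =
      (x : Fin k) → Any (Hit (σ [ i ≔ x ])) os ⊎ Refuted (suc i) plan (σ [ i ≔ x ])

    refuted? : ∀ i plan σ → Dec (Refuted i plan σ)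
    refuted? i []          σ = no λ ()
    refuted? i (os ∷ plan) σ =
      all? λ x → any? (hit? (σ [ i ≔ x ])) os ⊎-dec refuted? (suc i) plan (σ [ i ≔ x ])

    module _ (c : EdgeColouring G k) where

      colours : ℕ → Fin k
      colours j = uncurry (col c) (edge j)

      Extends : Assignment → Set
      Extends σ = ∀ j {x} → σ j ≡ just x → colours j ≡ x

      unassigned-extends : Extends unassigned
      unassigned-extends _ ()

      update-extends : ∀ {σ i x} → Extends σ → colours i ≡ x → Extends (σ [ i ≔ x ])
      update-extends {i = i} ext eq j p with i ≡ᵇ j in i≡ᵇj
      ... | true  = trans (cong colours (sym (≡ᵇ⇒≡ i j (subst T (sym i≡ᵇj) tt))))
                          (trans eq (just-injective p))
      ... | false = ext j p

      ≐-extends : ∀ {σ} → Extends σ → ∀ i j → σ i ≐ σ j → colours i ≡ colours j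
      ≐-extends {σ} ext i j same with σ i in σi | σ j in σj
      ... | just x | just y = trans (ext i σi) (trans same (sym (ext j σj)))

      hit-extends : ∀ {σ} → Extends σ → ∀ o → Hit σ o → Hit (just ∘ colours) o
      hit-extends ext (clash _ _ _ i j) h = ≐-extends ext i j h
      hit-extends ext (alternation _ _ _ _ _ i₁ i₂ i₃ i₄) (h₁₃ , h₂₄) =
        ≐-extends ext i₁ i₃ h₁₃ , ≐-extends ext i₂ i₄ h₂₄

      joins-colour : ∀ {e u v} → Joins e u v → Adj G u v → uncurry (col c) e ≡ col c u v
      joins-colour (inj₁ (refl , refl)) _ = refl
      joins-colour (inj₂ (refl , refl)) a = sym (col-sym c a)

      star-avoids : IsStarEdgeColouring G c → ∀ o → Genuine o → ¬ Hit (just ∘ colours) o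
      star-avoids (proper , _) (clash u v w i j) (a₁ , a₂ , u≢w , j₁ , j₂) same =
        proper a₁ a₂ u≢w (trans (sym (joins-colour j₁ a₁)) (trans same (joins-colour j₂ a₂)))
      star-avoids (_ , no-bichromatic) (alternation v₀ v₁ v₂ v₃ v₄ i₁ i₂ i₃ i₄)
        ((a₁ , a₂ , a₃ , a₄) , (d₀₁ , d₀₂ , d₀₃ , d₁₂ , d₁₃ , d₂₃ , d₄₁ , d₄₂ , d₄₃) , (j₁ , j₂ , j₃ , j₄))
        (c₁₃ , c₂₄) =
        no-bichromatic (v₀ , v₁ , v₂ , v₃ , v₄ , a₁ , a₂ , a₃ , a₄ ,
                        d₀₁ , d₀₂ , d₀₃ , d₁₂ , d₁₃ , d₂₃ , d₄₁ , d₄₂ , d₄₃ ,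
                        trans (sym (joins-colour j₁ a₁)) (trans c₁₃ (joins-colour j₃ a₃)) ,
                        trans (sym (joins-colour j₂ a₂)) (trans c₂₄ (joins-colour j₄ a₄)))

      refuted-sound : IsStarEdgeColouring G c → ∀ {i plan σ} → Extends σ →
                      All (All Genuine) plan → ¬ Refuted i plan σ
      refuted-sound star {i} {os ∷ plan} ext (genuine ∷ genuines) refuted
        with refuted (colours i)
      ... | inj₁ hit = let o = Any.lookup hit ; (g , h) = lookupAny genuine hit in
                       star-avoids star o g (hit-extends (update-extends {i = i} ext refl) o h)
      ... | inj₂ rest = refuted-sound star (update-extends ext refl) genuines rest

  module Plan (size : ℕ) where
    open RawMonad (monad {0ℓ})

    incidences : V G → List (V G × ℕ)
    incidences v = do
      j ← upTo size
      let (a , b) = edge j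
      if does (a ≟ v) then (b , j) ∷ [] else if does (b ≟ v) then (a , j) ∷ [] else []

    darts : List (V G × V G × ℕ)
    darts = do
      j ← upTo size
      let (a , b) = edge j
      (a , b , j) ∷ (b , a , j) ∷ []

    onward : ℕ → V G → List (V G × ℕ)
    onward i v = filter (λ (_ , j) → ¬? (i ≟ⁿ j)) (incidences v)

    -- A walk and its reverse give the same constraint, so only one of them is kept.
    candidates : List Obstruction
    candidates = clashes ++ alternations
      where
      clashes alternations : List Obstruction
      clashes = do
        (v₀ , v₁ , i) ← darts ; (v₂ , j) ← onward i v₁
        if i <ᵇ j then pure (clash v₀ v₁ v₂ i j) else []
      alternations = do
        (v₀ , v₁ , i₁) ← darts ; (v₂ , i₂) ← onward i₁ v₁
        (v₃ , i₃) ← onward i₂ v₂ ; (v₄ , i₄) ← onward i₃ v₃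
        if i₁ <ᵇ i₄ then pure (alternation v₀ v₁ v₂ v₃ v₄ i₁ i₂ i₃ i₄) else []

    stage : Obstruction → ℕ
    stage (clash _ _ _ i j)                    = i ⊔ j
    stage (alternation _ _ _ _ _ i₁ i₂ i₃ i₄) = i₁ ⊔ i₂ ⊔ i₃ ⊔ i₄

    stages : ℕ → ℕ → List Obstruction → List (List Obstruction)
    stages i zero    os = []
    stages i (suc r) os = filter (λ o → i ≟ⁿ stage o) os ∷ stages (suc i) r os

    stages-genuine : ∀ i r {os} → All Genuine os → All (All Genuine) (stages i r os)
    stages-genuine i zero    _       = []
    stages-genuine i (suc r) genuine = filter⁺ _ genuine ∷ stages-genuine (suc i) r genuine

    plan : List (List Obstruction)
    plan = stages 4 (size ∸ 4) (filter genuine? candidates)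

    plan-genuine : All (All Genuine) plan
    plan-genuine = stages-genuine 4 (size ∸ 4) (all-filter genuine? candidates)

    star-clash : ℕ → ℕ → Obstruction
    star-clash i j = clash (proj₁ (edge i)) (proj₂ (edge i)) (proj₁ (edge j)) i j

    star-clashes : List Obstruction
    star-clashes = star-clash 0 1 ∷ star-clash 0 2 ∷ star-clash 0 3 ∷
                   star-clash 1 2 ∷ star-clash 1 3 ∷ star-clash 2 3 ∷ []

    canonical : Assignment {5}
    canonical = unassigned [ 0 ≔ 0F ] [ 1 ≔ 1F ] [ 2 ≔ 2F ] [ 3 ≔ 3F ]

    -- The first four edges meet at one vertex, so their colours are distinct and a permutation
    -- of the colours makes them 0, 1, 2, 3.
    no-star-5-colouring : All Genuine star-clashes → Refuted 4 plan canonical → ¬ StarColourable G 5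
    no-star-5-colouring (g₀₁ ∷ g₀₂ ∷ g₀₃ ∷ g₁₂ ∷ g₁₃ ∷ g₂₃ ∷ []) refuted (c , star) =
      let π , π-injective , e₀ , e₁ , e₂ , e₃ = normalising-recolouring
            (distinct g₀₁) (distinct g₀₂) (distinct g₀₃) (distinct g₁₂) (distinct g₁₃) (distinct g₂₃)
          c' = recolour π c
      in refuted-sound c' (recolour-star π-injective c star)
           (update-extends c' (update-extends c' (update-extends c' (update-extends c'
             (unassigned-extends c') e₀) e₁) e₂) e₃)
           plan-genuine refuted
      where
      distinct : ∀ {i j} → Genuine (star-clash i j) → colours c i ≢ colours c j
      distinct = star-avoids c star _

lookupOr : {A : Set} → A → List A → ℕ → A
lookupOr d []       _       = d
lookupOr d (x ∷ _)  zero    = x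
lookupOr d (_ ∷ xs) (suc j) = lookupOr d xs j

C₃□P₃-not-star-5 : ¬ StarColourable (CycleBoxPath 3 3) 5
C₃□P₃-not-star-5 =
  no-star-5-colouring (from-yes (All.all? genuine? star-clashes)) (from-yes (refuted? 4 plan canonical))
  where
  order : List ((Fin 3 × Fin 3) × (Fin 3 × Fin 3))
  order =
    ((0F , 1F) , (1F , 1F)) ∷ ((1F , 0F) , (1F , 1F)) ∷ ((1F , 2F) , (1F , 1F)) ∷ ((2F , 1F) , (1F , 1F)) ∷
    ((0F , 1F) , (2F , 1F)) ∷ ((0F , 0F) , (0F , 1F)) ∷ ((0F , 0F) , (1F , 0F)) ∷ ((0F , 1F) , (0F , 2F)) ∷
    ((0F , 2F) , (1F , 2F)) ∷ ((1F , 0F) , (2F , 0F)) ∷ ((1F , 2F) , (2F , 2F)) ∷ ((2F , 0F) , (2F , 1F)) ∷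
    ((2F , 1F) , (2F , 2F)) ∷ ((0F , 0F) , (2F , 0F)) ∷ ((0F , 2F) , (2F , 2F)) ∷ []
  open Certificate (CycleBoxPath 3 3) (CycleBoxPath-adjacent? 3 3) (≡-dec _≟ᶠ_ _≟ᶠ_)
                   (lookupOr ((0F , 0F) , (0F , 0F)) order)
  open Plan (length order)

P₅□P₃-not-star-5 : ¬ StarColourable (PathBoxPath 5 3) 5
P₅□P₃-not-star-5 =
  no-star-5-colouring (from-yes (All.all? genuine? star-clashes)) (from-yes (refuted? 4 plan canonical))
  where
  order : List ((Fin 5 × Fin 3) × (Fin 5 × Fin 3))
  order =
    ((1F , 1F) , (2F , 1F)) ∷ ((2F , 0F) , (2F , 1F)) ∷ ((2F , 2F) , (2F , 1F)) ∷ ((3F , 1F) , (2F , 1F)) ∷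
    ((0F , 1F) , (1F , 1F)) ∷ ((1F , 0F) , (1F , 1F)) ∷ ((1F , 0F) , (2F , 0F)) ∷ ((1F , 1F) , (1F , 2F)) ∷
    ((1F , 2F) , (2F , 2F)) ∷ ((2F , 0F) , (3F , 0F)) ∷ ((2F , 2F) , (3F , 2F)) ∷ ((3F , 0F) , (3F , 1F)) ∷
    ((3F , 1F) , (3F , 2F)) ∷ ((3F , 1F) , (4F , 1F)) ∷ ((0F , 0F) , (0F , 1F)) ∷ ((0F , 0F) , (1F , 0F)) ∷
    ((0F , 1F) , (0F , 2F)) ∷ ((0F , 2F) , (1F , 2F)) ∷ ((3F , 0F) , (4F , 0F)) ∷ ((3F , 2F) , (4F , 2F)) ∷
    ((4F , 0F) , (4F , 1F)) ∷ ((4F , 1F) , (4F , 2F)) ∷ []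
  open Certificate (PathBoxPath 5 3) (PathBoxPath-adjacent? 5 3) (≡-dec _≟ᶠ_ _≟ᶠ_)
                   (lookupOr ((0F , 0F) , (0F , 0F)) order)
  open Plan (length order)

C₃□Pₙ-not-star-5 : 3 ≤ n → ¬ StarColourable (CycleBoxPath 3 n) 5
C₃□Pₙ-not-star-5 3≤n = C₃□P₃-not-star-5 ∘ StarColourable-↪ (CycleBoxPath-↪ 3≤n)

Cₘ□Pₙ-not-star-5 : 5 ≤ m → 3 ≤ n → ¬ StarColourable (CycleBoxPath m n) 5
Cₘ□Pₙ-not-star-5 5≤m 3≤n = P₅□P₃-not-star-5 ∘ StarColourable-↪ (PathBoxPath-↪ 5≤m 3≤n)

C₃ₖ□Pₙ-not-star-5 : ∀ k → 1 ≤ k → 3 ≤ n → ¬ StarColourable (CycleBoxPath (3 * k) n) 5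
C₃ₖ□Pₙ-not-star-5 1             _ 3≤n = C₃□Pₙ-not-star-5 3≤n
C₃ₖ□Pₙ-not-star-5 (suc (suc k)) _ 3≤n =
  Cₘ□Pₙ-not-star-5 (≤-trans (n≤1+n 5) (*-monoʳ-≤ 3 (s≤s (s≤s (z≤n {k}))))) 3≤n

theorem22 : (k : ℕ) → 1 ≤ k → (n : ℕ) → 3 ≤ n →
    StarChromaticIndex≡ (CycleBoxPath (3 * k) n) 6
theorem22 k 1≤k n 3≤n =
  CycleBoxPath-star-6 (m∣m*n k) , ¬StarColourable⇒< (C₃ₖ□Pₙ-not-star-5 k 1≤k 3≤n)
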